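{- For all integers $t,k\ge 1$, $\delta_{t,1}(\mathbb{Z}^2)\ge \delta_{t+k,1+2k}(\mathbb{Z}^2)$.
   Context: $\mathbb{Z}^2$ denotes the infinite grid graph, whose graph distance is the $\ell_1$ distance. For positive integers $t,r$, a set $\mathcal{T}\subseteq\mathbb{Z}^2$ is $(t,r)$ broadcasting if every vertex $v$ satisfies $\sum_{u\in\mathcal{T}}\max\{0,t-d(u,v)\}\ge r$. The density of $\mathcal{T}$ is $\limsup_{n\to\infty}\frac{|\mathcal{T}\cap[-n,n]^2|}{(2n+1)^2}$, and $\delta_{t,r}(\mathbb{Z}^2)$ is the minimal density of a $(t,r)$ broadcasting set in $\mathbb{Z}^2$. -}

module Defs where

open import Data.Bool using (Bool; true; false)
open import Data.Nat as ℕ using (ℕ; zero; suc; _∸_)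
open import Data.Integer as ℤ using (ℤ; +_; -_; ∣_∣)
open import Data.Rational as ℚ using (ℚ; _/_; 0ℚ)
open import Data.Product using (_×_; _,_; Σ; ∃)

Point : Set
Point = ℤ × ℤ

Subset² : Set
Subset² = Point → Bool

-- Graph distance of the grid ℤ² = ℓ₁ distance.
dist : Point → Point → ℕ
dist (x₁ , y₁) (x₂ , y₂) = ∣ x₁ ℤ.- x₂ ∣ ℕ.+ ∣ y₁ ℤ.- y₂ ∣

𝟙 : Bool → ℕ
𝟙 true  = 1
𝟙 false = 0

sumFrom : ℤ → ℕ → (ℤ → ℕ) → ℕ
sumFrom lo zero    f = 0
sumFrom lo (suc m) f = f lo ℕ.+ sumFrom (ℤ.suc lo) m f

sumAround : ℤ → ℕ → (ℤ → ℕ) → ℕ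
sumAround c n f = sumFrom (c ℤ.- (+ n)) (suc (2 ℕ.* n)) f

-- Every u with d(u,v) < t lies in the box
-- v + [-t,t]², and every other u contributes max{0,t-d} = t ∸ d = 0, so
-- summing over that box is exactly the (finite) sum over all of 𝒯.
reception : ℕ → Subset² → Point → ℕ
reception t T (vx , vy) =
  sumAround vx t λ x → sumAround vy t λ y →
    𝟙 (T (x , y)) ℕ.* (t ∸ dist (x , y) (vx , vy))

Broadcasting : ℕ → ℕ → Subset² → Set
Broadcasting t r T = ∀ (v : Point) → r ℕ.≤ reception t T v

countBox : Subset² → ℕ → ℕ
countBox T n = sumAround (+ 0) n λ x → sumAround (+ 0) n λ y → 𝟙 (T (x , y))

ℕtoℚ : ℕ → ℚ
ℕtoℚ n = (+ n) / 1

-- density(𝒯) = limsup_n |𝒯 ∩ [-n,n]²| / (2n+1)²  ≤ q,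
-- i.e. for every ε > 0, eventually |𝒯 ∩ [-n,n]²| ≤ (q + ε)(2n+1)².
DensityLe : Subset² → ℚ → Set
DensityLe T q =
  ∀ (ε : ℚ) → 0ℚ ℚ.< ε →
    ∃ λ (N : ℕ) → ∀ (n : ℕ) → N ℕ.≤ n →
      ℕtoℚ (countBox T n) ℚ.≤ (q ℚ.+ ε) ℚ.* ℕtoℚ (suc (2 ℕ.* n) ℕ.* suc (2 ℕ.* n))

-- δ_{t,r}(ℤ²) ≤ q, where δ_{t,r}(ℤ²) is the minimal (= infimal) density of a
-- (t,r) broadcasting set: for every ε > 0 there is a (t,r) broadcasting set
-- of density ≤ q + ε.
MinDensityLe : ℕ → ℕ → ℚ → Set
MinDensityLe t r q =
  ∀ (ε : ℚ) → 0ℚ ℚ.< ε →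
    Σ Subset² λ T → Broadcasting t r T × DensityLe T (q ℚ.+ ε)

-- δ_{t₁,r₁}(ℤ²) ≤ δ_{t₂,r₂}(ℤ²)  (as extended reals / reals in [0,1]):
-- every rational upper bound of the right side is one of the left side.
MinDensity≤ : ℕ → ℕ → ℕ → ℕ → Set
MinDensity≤ t₁ r₁ t₂ r₂ = ∀ (q : ℚ) → MinDensityLe t₂ r₂ q → MinDensityLe t₁ r₁ q

-- A (t,1) broadcasting set is already (t+k, 1+2k) broadcasting, so the infimal densities compare
-- the same way. Given v, take a transmitter u with d = d(u,v) < t and put j = t - d. Walking j steps
-- from v directly away from u reaches w with d(u,w) = t, so the transmitter u' hearing w is not u,
-- and d(u',v) < t + j. With power t + k the two of them deliver
-- (t + k - d) + (t + k - d(u',v)) ≥ (j + k) + (k - j + 1) = 2k + 1 at v.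
module Submission where

open import Defs
open import Data.Nat using (ℕ; _+_; _*_; _≤_)

open import Data.Nat as ℕ using (zero; suc; _∸_; _<_; s≤s)
import Data.Nat.Properties as ℕP
open import Data.Nat.Tactic.RingSolver using (solve)
open import Data.List using (_∷_; [])
open import Data.Integer as ℤ using (ℤ; +_; -_; ∣_∣; -[1+_])
import Data.Integer.Properties as ℤP
import Data.Integer.Tactic.RingSolver as ℤSolver
open import Data.Bool using (true)
open import Data.Product using (_×_; _,_; ∃)
open import Data.Empty using (⊥-elim)
open import Relation.Nullary using (¬_; yes; no; contradiction)
open import Relation.Binary.PropositionalEquality
open import Algebra.Properties.CommutativeSemigroup ℕP.+-commutativeSemigroup
  using () renaming (interchange to +-interchange; xy∙z≈xz∙y to +-right-comm)

sumFrom-pos⇒∃-pos : ∀ lo len (f : ℤ → ℕ) → 1 ≤ sumFrom lo len f → ∃ λ x → 1 ≤ f x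
sumFrom-pos⇒∃-pos lo (suc len) f h with f lo in eq
... | suc _ = lo , subst (1 ≤_) (sym eq) (s≤s ℕ.z≤n)
... | zero  = sumFrom-pos⇒∃-pos (ℤ.suc lo) len f h

+-suc-offset : ∀ lo i → lo ℤ.+ + suc i ≡ ℤ.suc lo ℤ.+ + i
+-suc-offset lo i = trans (cong (λ z → lo ℤ.+ z) (ℤP.pos-+ 1 i)) (shuffle lo (+ i))
  where
  shuffle : ∀ a b → a ℤ.+ (ℤ.1ℤ ℤ.+ b) ≡ (ℤ.1ℤ ℤ.+ a) ℤ.+ b
  shuffle = ℤSolver.solve-∀

sumFrom-single : ∀ lo len (f : ℤ → ℕ) i → i < len → f (lo ℤ.+ + i) ≤ sumFrom lo len f
sumFrom-single lo (suc len) f zero    _ rewrite ℤP.+-identityʳ lo = ℕP.m≤m+n (f lo) _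
sumFrom-single lo (suc len) f (suc i) (s≤s i<len) rewrite +-suc-offset lo i =
  ℕP.≤-trans (sumFrom-single (ℤ.suc lo) len f i i<len) (ℕP.m≤n+m _ (f lo))

sumFrom-pair : ∀ lo len (f : ℤ → ℕ) i j → i < len → j < len → i ≢ j →
  f (lo ℤ.+ + i) + f (lo ℤ.+ + j) ≤ sumFrom lo len f
sumFrom-pair lo (suc len) f zero    zero    _ _ i≢j = ⊥-elim (i≢j refl)
sumFrom-pair lo (suc len) f zero    (suc j) _ (s≤s j<len) _
  rewrite ℤP.+-identityʳ lo | +-suc-offset lo j =
  ℕP.+-monoʳ-≤ (f lo) (sumFrom-single (ℤ.suc lo) len f j j<len)
sumFrom-pair lo (suc len) f (suc i) zero    (s≤s i<len) _ _
  rewrite ℤP.+-identityʳ lo | +-suc-offset lo i | ℕP.+-comm (f (ℤ.suc lo ℤ.+ + i)) (f lo) =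
  ℕP.+-monoʳ-≤ (f lo) (sumFrom-single (ℤ.suc lo) len f i i<len)
sumFrom-pair lo (suc len) f (suc i) (suc j) (s≤s i<len) (s≤s j<len) si≢sj
  rewrite +-suc-offset lo i | +-suc-offset lo j =
  ℕP.≤-trans (sumFrom-pair (ℤ.suc lo) len f i j i<len j<len (λ i≡j → si≢sj (cong suc i≡j)))
             (ℕP.m≤n+m _ (f lo))

∣-∣≤⇒offset : ∀ c n x → ∣ x ℤ.- c ∣ ≤ n →
  ∃ λ i → i < suc (2 * n) × x ≡ (c ℤ.- + n) ℤ.+ + i
∣-∣≤⇒offset c n x h with x ℤ.- c in eq
... | + m = n + m , s≤s (ℕP.+-monoʳ-≤ n (ℕP.≤-trans h (ℕP.m≤m+n n 0))) , (begin
    x                             ≡⟨ recentre x c ⟩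
    c ℤ.+ (x ℤ.- c)               ≡⟨ cong (λ z → c ℤ.+ z) eq ⟩
    c ℤ.+ + m                     ≡⟨ insert c (+ n) (+ m) ⟩
    (c ℤ.- + n) ℤ.+ (+ n ℤ.+ + m) ≡⟨ cong (λ z → (c ℤ.- + n) ℤ.+ z) (sym (ℤP.pos-+ n m)) ⟩
    (c ℤ.- + n) ℤ.+ + (n + m)     ∎)
  where
  open ≡-Reasoning
  recentre : ∀ x c → x ≡ c ℤ.+ (x ℤ.- c)
  recentre = ℤSolver.solve-∀
  insert : ∀ c a b → c ℤ.+ b ≡ (c ℤ.- a) ℤ.+ (a ℤ.+ b)
  insert = ℤSolver.solve-∀
... | -[1+ m ] = n ∸ suc m , s≤s (ℕP.≤-trans (ℕP.m∸n≤m n (suc m)) (ℕP.m≤m+n n (n + 0))) , (begin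
    x                                        ≡⟨ recentre x c ⟩
    c ℤ.+ (x ℤ.- c)                          ≡⟨ cong (λ z → c ℤ.+ z) eq ⟩
    c ℤ.- + suc m                            ≡⟨ insert c (+ suc m) (+ r) ⟩
    (c ℤ.- (+ suc m ℤ.+ + r)) ℤ.+ + r        ≡⟨ cong (λ z → (c ℤ.- z) ℤ.+ + r) (sym (ℤP.pos-+ (suc m) r)) ⟩
    (c ℤ.- + (suc m + r)) ℤ.+ + r            ≡⟨ cong (λ z → (c ℤ.- + z) ℤ.+ + r) (ℕP.m+[n∸m]≡n h) ⟩
    (c ℤ.- + n) ℤ.+ + r                      ∎)
  where
  open ≡-Reasoning
  r : ℕ
  r = n ∸ suc m
  recentre : ∀ x c → x ≡ c ℤ.+ (x ℤ.- c)
  recentre = ℤSolver.solve-∀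
  insert : ∀ c a b → c ℤ.- a ≡ (c ℤ.- (a ℤ.+ b)) ℤ.+ b
  insert = ℤSolver.solve-∀

sumAround-single : ∀ c n (f : ℤ → ℕ) x → ∣ x ℤ.- c ∣ ≤ n → f x ≤ sumAround c n f
sumAround-single c n f x h with ∣-∣≤⇒offset c n x h
... | i , i<len , refl = sumFrom-single _ _ f i i<len

sumAround-pair : ∀ c n (f : ℤ → ℕ) x x' → ∣ x ℤ.- c ∣ ≤ n → ∣ x' ℤ.- c ∣ ≤ n → x ≢ x' →
  f x + f x' ≤ sumAround c n f
sumAround-pair c n f x x' h h' x≢x' with ∣-∣≤⇒offset c n x h | ∣-∣≤⇒offset c n x' h'
... | i , i<len , refl | i' , i'<len , refl =
  sumFrom-pair _ _ f i i' i<len i'<len (λ i≡i' → x≢x' (cong (λ i → (c ℤ.- + n) ℤ.+ + i) i≡i'))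

sumAround²-single : ∀ cx cy n (G : ℤ → ℤ → ℕ) x y → ∣ x ℤ.- cx ∣ ≤ n → ∣ y ℤ.- cy ∣ ≤ n →
  G x y ≤ sumAround cx n (λ a → sumAround cy n (G a))
sumAround²-single cx cy n G x y hx hy =
  ℕP.≤-trans (sumAround-single cy n (G x) y hy) (sumAround-single cx n _ x hx)

sumAround²-pair : ∀ cx cy n (G : ℤ → ℤ → ℕ) x y x' y' →
  ∣ x ℤ.- cx ∣ ≤ n → ∣ y ℤ.- cy ∣ ≤ n → ∣ x' ℤ.- cx ∣ ≤ n → ∣ y' ℤ.- cy ∣ ≤ n →
  (x , y) ≢ (x' , y') → G x y + G x' y' ≤ sumAround cx n (λ a → sumAround cy n (G a))
sumAround²-pair cx cy n G x y x' y' hx hy hx' hy' p≢p' with x ℤP.≟ x'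
... | yes refl = ℕP.≤-trans (sumAround-pair cy n (G x) y y' hy hy' (λ y≡y' → p≢p' (cong (x ,_) y≡y')))
                            (sumAround-single cx n _ x hx)
... | no x≢x'  = ℕP.≤-trans (ℕP.+-mono-≤ (sumAround-single cy n (G x) y hy) (sumAround-single cy n (G x') y' hy'))
                            (sumAround-pair cx n _ x x' hx hx' x≢x')

∣-∣-triangle : ∀ a b c → ∣ a ℤ.- c ∣ ≤ ∣ a ℤ.- b ∣ + ∣ b ℤ.- c ∣
∣-∣-triangle a b c = subst (λ z → ∣ z ∣ ≤ ∣ a ℤ.- b ∣ + ∣ b ℤ.- c ∣) (sym (split a b c))
                           (ℤP.∣i+j∣≤∣i∣+∣j∣ (a ℤ.- b) (b ℤ.- c))
  where
  split : ∀ a b c → a ℤ.- c ≡ (a ℤ.- b) ℤ.+ (b ℤ.- c)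
  split = ℤSolver.solve-∀

dist-triangle : ∀ p q r → dist p r ≤ dist p q + dist q r
dist-triangle (a₁ , a₂) (b₁ , b₂) (c₁ , c₂) =
  ℕP.≤-trans (ℕP.+-mono-≤ (∣-∣-triangle a₁ b₁ c₁) (∣-∣-triangle a₂ b₂ c₂))
             (ℕP.≤-reflexive (+-interchange (∣ a₁ ℤ.- b₁ ∣) (∣ b₁ ℤ.- c₁ ∣) (∣ a₂ ℤ.- b₂ ∣) (∣ b₂ ℤ.- c₂ ∣)))

dist≤⇒∣x∣≤ : ∀ x y x' y' {n} → dist (x , y) (x' , y') ≤ n → ∣ x ℤ.- x' ∣ ≤ n
dist≤⇒∣x∣≤ x y x' y' = ℕP.≤-trans (ℕP.m≤m+n _ _)

dist≤⇒∣y∣≤ : ∀ x y x' y' {n} → dist (x , y) (x' , y') ≤ n → ∣ y ℤ.- y' ∣ ≤ n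
dist≤⇒∣y∣≤ x y x' y' = ℕP.≤-trans (ℕP.m≤n+m _ _)

∣-∣-step-away : ∀ a c j → ∃ λ b → ∣ a ℤ.- b ∣ ≡ ∣ a ℤ.- c ∣ + j × ∣ b ℤ.- c ∣ ≡ j
∣-∣-step-away a c j with a ℤ.- c in eq
... | + m = c ℤ.- + j , (begin
    ∣ a ℤ.- (c ℤ.- + j) ∣ ≡⟨ cong ∣_∣ (regroup a c (+ j)) ⟩
    ∣ (a ℤ.- c) ℤ.+ + j ∣ ≡⟨ cong (λ z → ∣ z ℤ.+ + j ∣) eq ⟩
    ∣ + m ℤ.+ + j ∣       ≡⟨ cong ∣_∣ (sym (ℤP.pos-+ m j)) ⟩
    m + j                 ∎) ,
  trans (cong ∣_∣ (cancel c (+ j))) (ℤP.∣-i∣≡∣i∣ (+ j))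
  where
  open ≡-Reasoning
  regroup : ∀ a c d → a ℤ.- (c ℤ.- d) ≡ (a ℤ.- c) ℤ.+ d
  regroup = ℤSolver.solve-∀
  cancel : ∀ c d → (c ℤ.- d) ℤ.- c ≡ - d
  cancel = ℤSolver.solve-∀
... | -[1+ m ] = c ℤ.+ + j , (begin
    ∣ a ℤ.- (c ℤ.+ + j) ∣       ≡⟨ cong ∣_∣ (regroup a c (+ j)) ⟩
    ∣ (a ℤ.- c) ℤ.- + j ∣       ≡⟨ cong (λ z → ∣ z ℤ.- + j ∣) eq ⟩
    ∣ - (+ suc m) ℤ.- + j ∣     ≡⟨ cong ∣_∣ (sym (ℤP.neg-distrib-+ (+ suc m) (+ j))) ⟩
    ∣ - (+ suc m ℤ.+ + j) ∣     ≡⟨ ℤP.∣-i∣≡∣i∣ (+ suc m ℤ.+ + j) ⟩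
    ∣ + suc m ℤ.+ + j ∣         ≡⟨ cong ∣_∣ (sym (ℤP.pos-+ (suc m) j)) ⟩
    suc m + j                   ∎) ,
  cong ∣_∣ (cancel c (+ j))
  where
  open ≡-Reasoning
  regroup : ∀ a c d → a ℤ.- (c ℤ.+ d) ≡ (a ℤ.- c) ℤ.- d
  regroup = ℤSolver.solve-∀
  cancel : ∀ c d → (c ℤ.+ d) ℤ.- c ≡ d
  cancel = ℤSolver.solve-∀

step-away : ∀ (u v : Point) j → ∃ λ w → dist u w ≡ dist u v + j × dist w v ≡ j
step-away (ux , uy) (vx , vy) j with ∣-∣-step-away ux vx j
... | wx , uw , wv = (wx , vy) ,
  trans (cong (_+ ∣ uy ℤ.- vy ∣) uw) (+-right-comm (∣ ux ℤ.- vx ∣) j (∣ uy ℤ.- vy ∣)) ,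
  trans (cong₂ _+_ wv (cong ∣_∣ (ℤP.+-inverseʳ vy))) (ℕP.+-identityʳ j)

signal : ℕ → Subset² → Point → ℤ → ℤ → ℕ
signal n T v x y = 𝟙 (T (x , y)) * (n ∸ dist (x , y) v)

signal-of-member : ∀ n T v x y → T (x , y) ≡ true → signal n T v x y ≡ n ∸ dist (x , y) v
signal-of-member n T v x y Tp rewrite Tp = ℕP.*-identityˡ _

out-of-range : ∀ {d n} → ¬ d ≤ n → n ∸ d ≡ 0
out-of-range d≰n = ℕP.m≤n⇒m∸n≡0 (ℕP.<⇒≤ (ℕP.≰⇒> d≰n))

reception-single : ∀ n T v u → T u ≡ true → n ∸ dist u v ≤ reception n T v
reception-single n T v@(vx , vy) u@(x , y) Tu with dist u v ℕP.≤? n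
... | yes u≤n = subst (_≤ reception n T v) (signal-of-member n T v x y Tu)
  (sumAround²-single vx vy n (signal n T v) x y (dist≤⇒∣x∣≤ x y vx vy u≤n) (dist≤⇒∣y∣≤ x y vx vy u≤n))
... | no u≰n rewrite out-of-range u≰n = ℕ.z≤n

reception-pair : ∀ n T v u u' → T u ≡ true → T u' ≡ true → u ≢ u' →
  (n ∸ dist u v) + (n ∸ dist u' v) ≤ reception n T v
reception-pair n T v@(vx , vy) u@(x , y) u'@(x' , y') Tu Tu' u≢u'
  with dist u v ℕP.≤? n | dist u' v ℕP.≤? n
... | no u≰n | _ rewrite out-of-range u≰n = reception-single n T v u' Tu'
... | _ | no u'≰n rewrite out-of-range u'≰n | ℕP.+-identityʳ (n ∸ dist u v) = reception-single n T v u Tu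
... | yes u≤n | yes u'≤n =
  subst (_≤ reception n T v) (cong₂ _+_ (signal-of-member n T v x y Tu) (signal-of-member n T v x' y' Tu'))
    (sumAround²-pair vx vy n (signal n T v) x y x' y'
      (dist≤⇒∣x∣≤ x y vx vy u≤n) (dist≤⇒∣y∣≤ x y vx vy u≤n)
      (dist≤⇒∣x∣≤ x' y' vx vy u'≤n) (dist≤⇒∣y∣≤ x' y' vx vy u'≤n) u≢u')

heard⇒member : ∀ b t d → 1 ≤ 𝟙 b * (t ∸ d) → b ≡ true × d < t
heard⇒member true t d h =
  refl , ℕP.m∸n≢0⇒n<m (λ t∸d≡0 → contradiction (subst (λ m → 1 ≤ 1 * m) t∸d≡0 h) λ ())

nearby-transmitter : ∀ t T v → Broadcasting t 1 T → ∃ λ u → T u ≡ true × dist u v < t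
nearby-transmitter t T v@(vx , vy) bc
  with sumFrom-pos⇒∃-pos (vx ℤ.- + t) (suc (2 * t)) (λ x → sumAround vy t (signal t T v x)) (bc v)
... | x , hx with sumFrom-pos⇒∃-pos (vy ℤ.- + t) (suc (2 * t)) (signal t T v x) hx
... | y , hxy = (x , y) , heard⇒member (T (x , y)) t _ hxy

two-signals : ∀ t k d d' j → d + j ≡ t → d' < t + j → 1 + 2 * k ≤ (t + k ∸ d) + (t + k ∸ d')
two-signals _ k d d' j refl d'<t+j = begin
  1 + 2 * k       ≡⟨ solve (k ∷ []) ⟩
  suc k + k       ≤⟨ ℕP.+-monoˡ-≤ k k<j+r ⟩
  (j + r) + k     ≡⟨ +-right-comm j r k ⟩
  (j + k) + r     ≡⟨ cong (_+ r) (sym t+k∸d≡j+k) ⟩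
  (t + k ∸ d) + r ∎
  where
  open ℕP.≤-Reasoning
  t r : ℕ
  t = d + j
  r = t + k ∸ d'
  t+k∸d≡j+k : t + k ∸ d ≡ j + k
  t+k∸d≡j+k = trans (cong (_∸ d) (ℕP.+-assoc d j k)) (ℕP.m+n∸m≡n d (j + k))
  k<j+r : suc k ≤ j + r
  k<j+r = ℕP.+-cancelˡ-≤ t _ _ (begin
    t + suc k   ≡⟨ ℕP.+-suc t k ⟩
    suc (t + k) ≤⟨ s≤s (ℕP.m≤n+m∸n (t + k) d') ⟩
    suc d' + r  ≤⟨ ℕP.+-monoˡ-≤ r d'<t+j ⟩
    (t + j) + r ≡⟨ ℕP.+-assoc t j r ⟩
    t + (j + r) ∎)

broadcasting-amplify : ∀ t k T → Broadcasting t 1 T → Broadcasting (t + k) (1 + 2 * k) T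
broadcasting-amplify t k T bc v with nearby-transmitter t T v bc
... | u , Tu , uv<t with step-away u v (t ∸ dist u v)
... | w , uw≡uv+j , wv≡j with nearby-transmitter t T w bc
... | u' , Tu' , u'w<t =
  ℕP.≤-trans (two-signals t k (dist u v) (dist u' v) j uv+j≡t u'v<t+j)
             (reception-pair (t + k) T v u u' Tu Tu' u≢u')
  where
  j : ℕ
  j = t ∸ dist u v
  uv+j≡t : dist u v + j ≡ t
  uv+j≡t = ℕP.m+[n∸m]≡n (ℕP.<⇒≤ uv<t)
  u≢u' : u ≢ u'
  u≢u' u≡u' = ℕP.<-irrefl (trans uw≡uv+j uv+j≡t) (subst (λ p → dist p w < t) (sym u≡u') u'w<t)
  u'v<t+j : dist u' v < t + j
  u'v<t+j = ℕP.≤-<-trans (dist-triangle u' w v)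
    (subst (λ z → dist u' w + z < t + j) (sym wv≡j) (ℕP.+-monoˡ-< j u'w<t))

proposition6 : ∀ (t k : ℕ) → 1 ≤ t → 1 ≤ k →
    MinDensity≤ (t + k) (1 + 2 * k) t 1
proposition6 t k _ _ q δ≤q ε ε>0 with δ≤q ε ε>0
... | T , broadcasting , density = T , broadcasting-amplify t k T broadcasting , density
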